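{- In every Ex-lattice, for all elements $p,q$: $\lnot\lnot p\wedge\lnot\lnot q\le\lnot\lnot(p\wedge q)$.
   Context: A fundamental lattice is a bounded lattice with unary $\lnot$ that is antitone, satisfies $a\wedge\lnot a=0$ and $a\le\lnot\lnot a$. An Ex-lattice is a fundamental lattice in which, for all $a,b,c,d,e,f$: $\lnot\big[a\wedge((b\wedge c)\vee(b\wedge d))\big]\wedge a\wedge(c\vee e)\wedge\lnot\lnot f \le \lnot\lnot(a\wedge f)\wedge\big[(a\wedge c)\vee(a\wedge e)\vee f\big]\wedge\big[(b\wedge(c\vee d))\vee\lnot(b\wedge(c\vee d))\big]$. -}

module Defs where

open import Level using (Level; _⊔_) renaming (suc to lsuc)
open import Relation.Binary.Lattice.Bundles using (BoundedLattice)

record FundamentalLattice c ℓ₁ ℓ₂ : Set (lsuc (c ⊔ ℓ₁ ⊔ ℓ₂)) where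
  field
    boundedLattice : BoundedLattice c ℓ₁ ℓ₂
  open BoundedLattice boundedLattice public
  field
    ¬_         : Carrier → Carrier
    ¬-antitone : ∀ {a b} → a ≤ b → ¬ b ≤ ¬ a
    ∧-¬≈⊥      : ∀ a → (a ∧ ¬ a) ≈ ⊥
    ≤¬¬        : ∀ a → a ≤ ¬ (¬ a)

record ExLattice c ℓ₁ ℓ₂ : Set (lsuc (c ⊔ ℓ₁ ⊔ ℓ₂)) where
  field
    fundamentalLattice : FundamentalLattice c ℓ₁ ℓ₂
  open FundamentalLattice fundamentalLattice public
  field
    ex : ∀ a b c d e f →
      ((((¬ (a ∧ ((b ∧ c) ∨ (b ∧ d)))) ∧ a) ∧ (c ∨ e)) ∧ ¬ (¬ f))
        ≤ (((¬ (¬ (a ∧ f))) ∧ (((a ∧ c) ∨ (a ∧ e)) ∨ f))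
            ∧ ((b ∧ (c ∨ d)) ∨ ¬ (b ∧ (c ∨ d))))

{-# OPTIONS --safe #-}
module Submission where

open import Defs
import Relation.Binary.Reasoning.PartialOrder as ≤-Reasoning

module FundamentalLatticeProperties {c ℓ₁ ℓ₂} (L : FundamentalLattice c ℓ₁ ℓ₂) where
  open FundamentalLattice L

  x≤¬⊥ : ∀ x → x ≤ ¬ ⊥
  x≤¬⊥ x = trans (maximum x) (trans (≤¬¬ ⊤) (¬-antitone (minimum (¬ ⊤))))

  ¬¬-monotone : ∀ {x y} → x ≤ y → ¬ (¬ x) ≤ ¬ (¬ y)
  ¬¬-monotone x≤y = ¬-antitone (¬-antitone x≤y)

  ¬¬¬≤¬ : ∀ x → ¬ (¬ (¬ x)) ≤ ¬ x
  ¬¬¬≤¬ x = ¬-antitone (≤¬¬ x)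

  x∧y≤y∧x : ∀ x y → (x ∧ y) ≤ (y ∧ x)
  x∧y≤y∧x x y = ∧-greatest (x∧y≤y x y) (x∧y≤x x y)

module ExLatticeProperties {c ℓ₁ ℓ₂} (L : ExLattice c ℓ₁ ℓ₂) where
  open ExLattice L
  open FundamentalLatticeProperties fundamentalLattice
  open ≤-Reasoning poset

  -- (Ex) with b = ⊥ and c = d = e = ⊤: the factor ¬ (a ∧ ((⊥ ∧ ⊤) ∨ (⊥ ∧ ⊤)))
  -- is ¬ ⊥, the top, so the premise is just a ∧ ¬¬ f.
  x∧¬¬y≤¬¬[x∧y] : ∀ a f → (a ∧ ¬ (¬ f)) ≤ ¬ (¬ (a ∧ f))
  x∧¬¬y≤¬¬[x∧y] a f = begin
    a ∧ ¬ (¬ f)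
      ≤⟨ ∧-greatest (∧-greatest (∧-greatest ¬-factor (x∧y≤x _ _)) ≤⊤∨⊤) (x∧y≤y _ _) ⟩
    (((¬ (a ∧ ((⊥ ∧ ⊤) ∨ (⊥ ∧ ⊤)))) ∧ a) ∧ (⊤ ∨ ⊤)) ∧ ¬ (¬ f)
      ≤⟨ trans (ex a ⊥ ⊤ ⊤ ⊤ f) (x∧y≤x _ _) ⟩
    ¬ (¬ (a ∧ f)) ∧ (((a ∧ ⊤) ∨ (a ∧ ⊤)) ∨ f)
      ≤⟨ x∧y≤x _ _ ⟩
    ¬ (¬ (a ∧ f)) ∎
    where
    ¬-factor : (a ∧ ¬ (¬ f)) ≤ ¬ (a ∧ ((⊥ ∧ ⊤) ∨ (⊥ ∧ ⊤)))
    ¬-factor = trans (x≤¬⊥ _) (¬-antitone (trans (x∧y≤y _ _) (∨-least (x∧y≤x _ _) (x∧y≤x _ _))))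
    ≤⊤∨⊤ : (a ∧ ¬ (¬ f)) ≤ (⊤ ∨ ⊤)
    ≤⊤∨⊤ = trans (maximum _) (x≤x∨y ⊤ ⊤)

  ¬¬x∧y≤¬¬[x∧y] : ∀ p q → (¬ (¬ p) ∧ q) ≤ ¬ (¬ (p ∧ q))
  ¬¬x∧y≤¬¬[x∧y] p q = begin
    ¬ (¬ p) ∧ q     ≤⟨ x∧y≤y∧x _ _ ⟩
    q ∧ ¬ (¬ p)     ≤⟨ x∧¬¬y≤¬¬[x∧y] q p ⟩
    ¬ (¬ (q ∧ p))   ≤⟨ ¬¬-monotone (x∧y≤y∧x q p) ⟩
    ¬ (¬ (p ∧ q))   ∎

  ¬¬x∧¬¬y≤¬¬[x∧y] : ∀ p q → (¬ (¬ p) ∧ ¬ (¬ q)) ≤ ¬ (¬ (p ∧ q))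
  ¬¬x∧¬¬y≤¬¬[x∧y] p q = begin
    ¬ (¬ p) ∧ ¬ (¬ q)         ≤⟨ x∧¬¬y≤¬¬[x∧y] (¬ (¬ p)) q ⟩
    ¬ (¬ (¬ (¬ p) ∧ q))       ≤⟨ ¬¬-monotone (¬¬x∧y≤¬¬[x∧y] p q) ⟩
    ¬ (¬ (¬ (¬ (p ∧ q))))     ≤⟨ ¬¬¬≤¬ (¬ (p ∧ q)) ⟩
    ¬ (¬ (p ∧ q))             ∎

lemma3p4 : ∀ {c ℓ₁ ℓ₂} (L : ExLattice c ℓ₁ ℓ₂) → (p q : ExLattice.Carrier L) → ExLattice._≤_ L (ExLattice._∧_ L (ExLattice.¬_ L (ExLattice.¬_ L p)) (ExLattice.¬_ L (ExLattice.¬_ L q))) (ExLattice.¬_ L (ExLattice.¬_ L (ExLattice._∧_ L p q)))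
lemma3p4 L = ExLatticeProperties.¬¬x∧¬¬y≤¬¬[x∧y] L
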